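{- Let $G=(V,E^+,E^-)$ be a signed graph whose flow clutter $\mathcal F$ is weakly MNI, and let $x$ be a fractional vertex of $\mathsf P_{A(\mathcal F)}$ such that the clutter $\mathcal C=\mathcal F/E^-_0(x)$ is minimally non-ideal. If $E^-_0(x)\ne E^-$, then $\mathcal C$ is isomorphic neither to the blocker of $\tau(K_5)$ nor to $F_7$.
   Context: A signed graph $G=(V,E^+,E^-)$ is a (multi)graph with edge set $E=E^+\cup E^-$ partitioned into positive and negative edges. A circuit is a cycle without repeated vertices (as an edge set); a flow is a circuit with exactly one negative edge. The flow clutter $\mathcal F$ is the family of edge sets of flows of $G$, ground set $E$, and $\mathsf P_{A(\mathcal F)}=\{x\in\mathbb R^E: x\ge 0,\ \sum_{e\in C}x_e\ge1\ \forall C\in\mathcal F\}$. A vertex is fractional if it has a non-integer coordinate; $E^-_0(x)=\{e\in E^-: x_e=0\}$. A clutter $\mathcal C$ (family of subsets of a finite ground set, none containing another) is ideal if $\{x\ge0:\sum_{e\in C}x_e\ge1\ \forall C\in\mathcal C\}$ is integral. Contraction $\mathcal C/e$: inclusion-minimal sets among $\{C\setminus\{e\}\}$; deletion $\mathcal C\setminus e=\{C:e\notin C\}$; contracting a set means contracting each element; minors arise from sequences of these. $\mathcal C$ is minimally non-ideal if not ideal but every proper minor is ideal. A strong minor of $\mathcal F$ is a minor obtained by contracting positive edges and deleting arbitrary edges without creating singleton members (equivalently the flow clutter of a signed graph obtained from $G$ by contracting positive edges and deleting edges without creating self-loops); $\mathcal F$ is weakly MNI if it is not ideal but every proper strong minor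 is ideal. The blocker of a clutter is the clutter of inclusion-minimal sets meeting every member. $\tau(K_5)$ is the clutter on the 10 edges of the complete graph $K_5$ whose members are the edge sets of the 10 triangles. $F_7$ is the clutter on the 7 points of the Fano plane whose members are its 7 lines (3 points each). Isomorphism of clutters means a bijection of ground sets mapping members onto members.
   Formalization: Points of $\mathsf P_{A(\mathcal F)}$ and of the polyhedra of its minors, including $x$ and the vertices in the notions of ideal, minimally non-ideal and weakly MNI, have rational coordinates instead of real ones. -}

module Defs where

open import Data.Nat using (ℕ; zero; suc)
open import Data.Nat.DivMod using (_mod_)
open import Data.Fin using (Fin; toℕ; #_)
open import Data.Fin.Properties using (_≟_)
open import Data.Fin.Subset using (Subset; _∈_; _∉_; _⊆_; _∩_; _∪_; _─_; ⊥; ⊤; ⁅_⁆; ∣_∣; Nonempty; ∁)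
open import Data.Bool using (Bool; true; false; _∧_; _∨_; if_then_else_)
open import Data.Vec using (Vec; []; _∷_; lookup; tabulate)
open import Data.List using (List; []; _∷_; foldr; allFin)
open import Data.Bool.ListAction using (any)
open import Data.List.Relation.Unary.Any using (Any)
open import Data.Product using (Σ; ∃; _×_; _,_; proj₁; proj₂)
open import Data.Sum using (_⊎_)
open import Data.Rational using (ℚ; 0ℚ; 1ℚ; ½; _+_; _*_; _≤_)
import Data.Rational.Properties as ℚP
open import Relation.Nullary using (¬_)
open import Relation.Nullary.Decidable using (⌊_⌋)
open import Relation.Binary.PropositionalEquality using (_≡_; _≢_)
open import Function.Definitions using (Injective)

record Clutter (n : ℕ) : Set₁ where
  field
    ground : Subset n
    Mem    : Subset n → Set
open Clutter public

sumOver : ∀ {n} → Subset n → (Fin n → ℚ) → ℚ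
sumOver {n} X x = foldr (λ e acc → if lookup X e then x e + acc else acc) 0ℚ (allFin n)

-- The polyhedron {x ≥ 0 : x(C) ≥ 1 for all members C}, with coordinates
-- outside the ground set fixed to 0 (an isomorphic copy of P_{A(C)}).
InPoly : ∀ {n} → Clutter n → (Fin n → ℚ) → Set
InPoly C x =
  (∀ e → 0ℚ ≤ x e) ×
  (∀ e → e ∉ ground C → x e ≡ 0ℚ) ×
  (∀ X → Mem C X → 1ℚ ≤ sumOver X x)

IsVertex : ∀ {n} → Clutter n → (Fin n → ℚ) → Set
IsVertex C x =
  InPoly C x ×
  (∀ y z → InPoly C y → InPoly C z → (∀ e → x e ≡ ½ * (y e + z e)) → ∀ e → y e ≡ z e)

IsInteger : ℚ → Set
IsInteger q = ℚ.denominatorℕ q ≡ 1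

Integral : ∀ {n} → (Fin n → ℚ) → Set
Integral x = ∀ e → IsInteger (x e)

Fractional : ∀ {n} → (Fin n → ℚ) → Set
Fractional x = ∃ λ e → ¬ IsInteger (x e)

Ideal : ∀ {n} → Clutter n → Set
Ideal C = ∀ x → IsVertex C x → Integral x

MinorCand : ∀ {n} → Clutter n → Subset n → Subset n → Subset n → Set
MinorCand C I J Y = ∃ λ Cm → Mem C Cm × (Cm ∩ I ≡ ⊥) × (Y ≡ Cm ─ J)

minor : ∀ {n} → Clutter n → Subset n → Subset n → Clutter n
minor C I J = record
  { ground = ground C ─ (I ∪ J)
  ; Mem    = λ X → MinorCand C I J X × (∀ Y → MinorCand C I J Y → Y ⊆ X → Y ≡ X)
  }

ValidMinor : ∀ {n} → Clutter n → Subset n → Subset n → Set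
ValidMinor C I J = I ⊆ ground C × J ⊆ ground C × (I ∩ J ≡ ⊥)

ProperMinor : ∀ {n} → Clutter n → Subset n → Subset n → Set
ProperMinor C I J = ValidMinor C I J × Nonempty (I ∪ J)

MNI : ∀ {n} → Clutter n → Set
MNI C = ¬ Ideal C × (∀ I J → ProperMinor C I J → Ideal (minor C I J))

Transversal : ∀ {n} → Clutter n → Subset n → Set
Transversal C X = X ⊆ ground C × (∀ Cm → Mem C Cm → Nonempty (X ∩ Cm))

blocker : ∀ {n} → Clutter n → Clutter n
blocker C = record
  { ground = ground C
  ; Mem    = λ X → Transversal C X × (∀ Y → Transversal C Y → Y ⊆ X → Y ≡ X)
  }

image : ∀ {n m} → (Fin n → Fin m) → Subset n → Subset m
image {n} f X = tabulate (λ e' → any (λ e → lookup X e ∧ ⌊ f e ≟ e' ⌋) (allFin n))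

Iso : ∀ {n m} → Clutter n → Clutter m → Set
Iso {n} {m} C D = Σ (Fin n → Fin m) λ f → Σ (Fin m → Fin n) λ g →
  (∀ e → e ∈ ground C → f e ∈ ground D × g (f e) ≡ e) ×
  (∀ e' → e' ∈ ground D → g e' ∈ ground C × f (g e') ≡ e') ×
  (∀ X → X ⊆ ground C → (Mem C X → Mem D (image f X)) × (Mem D (image f X) → Mem C X))

-- Signed (multi)graphs: vertices Fin nV, edges Fin nE with endpoints;
-- `negative` is E⁻, its complement is E⁺.  Loops and parallel edges allowed.

record SignedGraph : Set where
  field
    nV nE    : ℕ
    ends     : Fin nE → Fin nV × Fin nV
    negative : Subset nE
open SignedGraph public

E⁻ : (G : SignedGraph) → Subset (nE G)
E⁻ G = negative G

E⁺ : (G : SignedGraph) → Subset (nE G)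
E⁺ G = ∁ (negative G)

Joins : (G : SignedGraph) → Fin (nE G) → Fin (nV G) → Fin (nV G) → Set
Joins G e a b = ends G e ≡ (a , b) ⊎ ends G e ≡ (b , a)

next : ∀ {m} → Fin (suc m) → Fin (suc m)
next {m} i = suc (toℕ i) mod (suc m)

-- Circuit: edge set of a closed walk v₀ e₀ v₁ … v_m e_m v₀ with distinct
-- vertices and distinct edges (length ≥ 1; length 1 = loop, 2 = parallel pair).
IsCircuit : (G : SignedGraph) → Subset (nE G) → Set
IsCircuit G C = Σ ℕ λ m → Σ (Fin (suc m) → Fin (nV G)) λ vs → Σ (Fin (suc m) → Fin (nE G)) λ es →
  Injective _≡_ _≡_ vs × Injective _≡_ _≡_ es ×
  (∀ i → Joins G (es i) (vs i) (vs (next i))) ×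
  (∀ e → (e ∈ C → ∃ λ i → es i ≡ e) × ((∃ λ i → es i ≡ e) → e ∈ C))

IsFlow : (G : SignedGraph) → Subset (nE G) → Set
IsFlow G C = IsCircuit G C × ∣ C ∩ E⁻ G ∣ ≡ 1

flowClutter : (G : SignedGraph) → Clutter (nE G)
flowClutter G = record { ground = ⊤ ; Mem = IsFlow G }

StrongProperMinor : (G : SignedGraph) → Subset (nE G) → Subset (nE G) → Set
StrongProperMinor G I J =
  ProperMinor (flowClutter G) I J × J ⊆ E⁺ G ×
  (∀ e → Mem (minor (flowClutter G) I J) ⁅ e ⁆ → Mem (flowClutter G) ⁅ e ⁆)

WeaklyMNI : SignedGraph → Set
WeaklyMNI G = ¬ Ideal (flowClutter G) ×
  (∀ I J → StrongProperMinor G I J → Ideal (minor (flowClutter G) I J))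

E⁻₀ : (G : SignedGraph) → (Fin (nE G) → ℚ) → Subset (nE G)
E⁻₀ G x = tabulate (λ e → lookup (negative G) e ∧ ⌊ x e ℚP.≟ 0ℚ ⌋)

-- τ(K₅): ground = the 10 edges of K₅, members = triangles.

k5edge : Fin 10 → Fin 5 × Fin 5
k5edge e = lookup ((# 0 , # 1) ∷ (# 0 , # 2) ∷ (# 0 , # 3) ∷ (# 0 , # 4) ∷ (# 1 , # 2) ∷
                   (# 1 , # 3) ∷ (# 1 , # 4) ∷ (# 2 , # 3) ∷ (# 2 , # 4) ∷ (# 3 , # 4) ∷ []) e

triangle : Fin 5 → Fin 5 → Fin 5 → Subset 10
triangle a b c = tabulate (λ e → inT (proj₁ (k5edge e)) ∧ inT (proj₂ (k5edge e)))
  where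
  inT : Fin 5 → Bool
  inT v = ⌊ v ≟ a ⌋ ∨ ⌊ v ≟ b ⌋ ∨ ⌊ v ≟ c ⌋

τK₅ : Clutter 10
τK₅ = record
  { ground = ⊤
  ; Mem    = λ X → ∃ λ a → ∃ λ b → ∃ λ c → a ≢ b × a ≢ c × b ≢ c × X ≡ triangle a b c
  }

fanoLines : List (Subset 7)
fanoLines =
  (⁅ # 0 ⁆ ∪ ⁅ # 1 ⁆ ∪ ⁅ # 3 ⁆) ∷ (⁅ # 1 ⁆ ∪ ⁅ # 2 ⁆ ∪ ⁅ # 4 ⁆) ∷
  (⁅ # 2 ⁆ ∪ ⁅ # 3 ⁆ ∪ ⁅ # 5 ⁆) ∷ (⁅ # 3 ⁆ ∪ ⁅ # 4 ⁆ ∪ ⁅ # 6 ⁆) ∷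
  (⁅ # 4 ⁆ ∪ ⁅ # 5 ⁆ ∪ ⁅ # 0 ⁆) ∷ (⁅ # 5 ⁆ ∪ ⁅ # 6 ⁆ ∪ ⁅ # 1 ⁆) ∷
  (⁅ # 6 ⁆ ∪ ⁅ # 0 ⁆ ∪ ⁅ # 2 ⁆) ∷ []

F₇ : Clutter 7
F₇ = record { ground = ⊤ ; Mem = λ X → Any (X ≡_) fanoLines }

-- Only a negative edge f outside E⁻₀(x) is needed. A member of F / E⁻₀(x) is
-- what is left of a flow after contraction, so it lies in a circuit and no
-- three of its elements share an end vertex; a member containing f is a whole
-- flow, which leaves the two ends u and v of f through two further, distinct
-- edges. An isomorphism carries this structure to the element p corresponding
-- to f. In F₇ each of the three lines through p then has one further point at u
-- and the other at v, and this forces some line avoiding p to have all three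
-- points at u or all at v. In the blocker of τ(K₅) there are two members
-- through p whose elements at u lie, together with p, in a common member.

module Submission where

open import Defs
open import Data.Bool using (Bool; true; false; T; not; _∨_)
open import Data.Bool.Properties using (T-≡; T-∧) renaming (_≟_ to _≟ᵇ_)
import Data.Empty as Empty
open import Data.Empty using (⊥-elim)
open import Data.Fin using (Fin; zero; suc; toℕ; fromℕ; inject₁)
open import Data.Fin.Properties using (_≟_; all?; any?; toℕ-injective; toℕ-fromℕ; toℕ-fromℕ<; toℕ-inject₁; toℕ<n; 0≢1+n; suc-injective)
open import Data.Fin.Relation.Unary.Top using (view; ‵fromℕ; ‵inject₁)
open import Data.Fin.Subset using (Subset; _∈_; _∉_; _⊆_; _⊂_; _∩_; _∪_; _─_; ⊥; ⊤; ⁅_⁆; ∣_∣; Nonempty)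
open import Data.Fin.Subset.Properties using (_∈?_; nonempty?; ⊆-antisym; x∈p∩q⁺; x∈p∩q⁻; x∈p∪q⁺; x∈p∪q⁻; x∈⁅x⁆; x∈⁅y⁆⇒x≡y; ∣⁅x⁆∣≡1; p⊂q⇒∣p∣<∣q∣; ∈⊤; ∉⊥)
open import Data.List using (List; _++_; map; allFin)
open import Data.List.Relation.Unary.All using (All; lookupAny)
import Data.List.Relation.Unary.All as All
open import Data.List.Relation.Unary.Any using (Any)
import Data.List.Relation.Unary.Any as Any
open import Data.List.Relation.Unary.Any.Properties using (any⁺; any⁻; tabulate⁺; tabulate⁻)
open import Data.Nat using (ℕ; zero; suc; _+_; _≤_; _<_; z≤n; s≤s)
open import Data.Nat.DivMod using (_%_; _mod_; n%n≡0; m<n⇒m%n≡m)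
open import Data.Nat.Properties using (1+n≢n; m+1+n≢n; <-irrefl; <⇒≤)
open import Data.Rational using (ℚ)
open import Data.Product using (∃; ∃₂; _×_; _,_; proj₁; proj₂)
open import Data.Sum using (_⊎_; inj₁; inj₂; [_,_]′)
open import Data.Vec using (_∷_; here; there; lookup; tabulate)
open import Data.Vec.Properties using (≡-dec; lookup∘tabulate; []=⇒lookup; lookup⇒[]=)
open import Function using (_∘_)
open import Function.Bundles using (Equivalence)
open import Relation.Nullary using (¬_; Dec; yes; no)
open import Relation.Nullary.Decidable using (⌊_⌋; _×-dec_; _→-dec_; ¬?; toWitness; fromWitness; decidable-stable)
open import Relation.Binary.PropositionalEquality using (_≡_; _≢_; refl; sym; trans; cong; subst; subst₂; module ≡-Reasoning)

open Equivalence using (to; from)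
open ≡-Reasoning

x∈p─q⁺ : ∀ {n} {p q : Subset n} {x} → x ∈ p → x ∉ q → x ∈ p ─ q
x∈p─q⁺ {p = true ∷ p} {false ∷ q} here    _   = here
x∈p─q⁺ {p = true ∷ p} {true ∷ q}  here    x∉q = ⊥-elim (x∉q here)
x∈p─q⁺ {p = _ ∷ p}    {_ ∷ q}     (there x∈p) x∉q = there (x∈p─q⁺ x∈p (x∉q ∘ there))

x∈p─q⁻ : ∀ {n} {p q : Subset n} {x} → x ∈ p ─ q → x ∈ p × x ∉ q
x∈p─q⁻ {p = true ∷ p}  {false ∷ q} here = here , λ ()
x∈p─q⁻ {p = true ∷ p}  {true ∷ q}  {zero} ()
x∈p─q⁻ {p = false ∷ p} {true ∷ q}  {zero} ()
x∈p─q⁻ {p = false ∷ p} {false ∷ q} {zero} ()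
x∈p─q⁻ {p = _ ∷ p}    {_ ∷ q}     (there x∈p─q) with x∈p─q⁻ x∈p─q
... | x∈p , x∉q = there x∈p , λ { (there x∈q) → x∉q x∈q }

∣p∣≡1⇒x≡y : ∀ {n} {p : Subset n} {x y} → ∣ p ∣ ≡ 1 → x ∈ p → y ∈ p → x ≡ y
∣p∣≡1⇒x≡y {p = p} {x} {y} ∣p∣≡1 x∈p y∈p with x ≟ y
... | yes x≡y = x≡y
... | no  x≢y = ⊥-elim (<-irrefl refl (subst₂ _<_ (∣⁅x⁆∣≡1 x) ∣p∣≡1 (p⊂q⇒∣p∣<∣q∣ ⁅x⁆⊂p)))
  where
  ⁅x⁆⊂p : ⁅ x ⁆ ⊂ p
  ⁅x⁆⊂p = (λ z∈⁅x⁆ → subst (_∈ p) (sym (x∈⁅y⁆⇒x≡y x z∈⁅x⁆)) x∈p) ,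
          y , y∈p , λ y∈⁅x⁆ → x≢y (sym (x∈⁅y⁆⇒x≡y x y∈⁅x⁆))

⊆∧≢⇒∃∉ : ∀ {n} {p q : Subset n} → p ⊆ q → p ≢ q → ∃ λ x → x ∈ q × x ∉ p
⊆∧≢⇒∃∉ {p = p} {q} p⊆q p≢q with any? (λ x → (x ∈? q) ×-dec ¬? (x ∈? p))
... | yes witness = witness
... | no  none    = ⊥-elim (p≢q (⊆-antisym p⊆q q⊆p))
  where
  q⊆p : q ⊆ p
  q⊆p {x} x∈q = decidable-stable (x ∈? p) (λ x∉p → none (x , x∈q , x∉p))

∈-tabulate⁺ : ∀ {n} {g : Fin n → Bool} {x} → T (g x) → x ∈ tabulate g
∈-tabulate⁺ {g = g} {x} gx = lookup⇒[]= x (tabulate g) (trans (lookup∘tabulate g x) (to T-≡ gx))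

∈-tabulate⁻ : ∀ {n} {g : Fin n → Bool} {x} → x ∈ tabulate g → T (g x)
∈-tabulate⁻ {g = g} {x} x∈ = from T-≡ (trans (sym (lookup∘tabulate g x)) ([]=⇒lookup x∈))

image⁺ : ∀ {n m} (f : Fin n → Fin m) {X e} → e ∈ X → f e ∈ image f X
image⁺ f {X} {e} e∈X = ∈-tabulate⁺ (any⁺ _ (tabulate⁺ e (from T-∧ (from T-≡ ([]=⇒lookup e∈X) , fromWitness refl))))

image⁻ : ∀ {n m} (f : Fin n → Fin m) X {e′} → e′ ∈ image f X → ∃ λ e → e ∈ X × f e ≡ e′
image⁻ {n} f X e′∈ with tabulate⁻ (any⁻ _ (allFin n) (∈-tabulate⁻ e′∈))
... | e , Pe with to T-∧ Pe
... | e∈X , fe≡e′ = e , lookup⇒[]= e X (to T-≡ e∈X) , toWitness fe≡e′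

image-inverse : ∀ {n m} {φ : Fin n → Fin m} {γ : Fin m → Fin n} → (∀ q → φ (γ q) ≡ q) →
                ∀ M → image φ (image γ M) ≡ M
image-inverse {φ = φ} {γ} φ∘γ M = ⊆-antisym ⊆M M⊆
  where
  ⊆M : image φ (image γ M) ⊆ M
  ⊆M q∈ with image⁻ φ (image γ M) q∈
  ... | e , e∈ , refl with image⁻ γ M e∈
  ...   | q , q∈M , refl = subst (_∈ M) (sym (φ∘γ q)) q∈M
  M⊆ : M ⊆ image φ (image γ M)
  M⊆ {q} q∈M = subst (_∈ image φ (image γ M)) (φ∘γ q) (image⁺ φ (image⁺ γ q∈M))

module _ {k} {a b c : Fin k} where

  ∈-triple₁ : a ∈ ⁅ a ⁆ ∪ ⁅ b ⁆ ∪ ⁅ c ⁆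
  ∈-triple₁ = x∈p∪q⁺ (inj₁ (x∈⁅x⁆ a))

  ∈-triple₂ : b ∈ ⁅ a ⁆ ∪ ⁅ b ⁆ ∪ ⁅ c ⁆
  ∈-triple₂ = x∈p∪q⁺ (inj₂ (x∈p∪q⁺ (inj₁ (x∈⁅x⁆ b))))

  ∈-triple₃ : c ∈ ⁅ a ⁆ ∪ ⁅ b ⁆ ∪ ⁅ c ⁆
  ∈-triple₃ = x∈p∪q⁺ (inj₂ (x∈p∪q⁺ (inj₂ (x∈⁅x⁆ c))))

  ∈-triple⁻ : ∀ {x} → x ∈ ⁅ a ⁆ ∪ ⁅ b ⁆ ∪ ⁅ c ⁆ → x ≡ a ⊎ x ≡ b ⊎ x ≡ c
  ∈-triple⁻ x∈ with x∈p∪q⁻ ⁅ a ⁆ _ x∈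
  ... | inj₁ x∈a = inj₁ (x∈⁅y⁆⇒x≡y a x∈a)
  ... | inj₂ x∈bc with x∈p∪q⁻ ⁅ b ⁆ ⁅ c ⁆ x∈bc
  ...   | inj₁ x∈b = inj₂ (inj₁ (x∈⁅y⁆⇒x≡y b x∈b))
  ...   | inj₂ x∈c = inj₂ (inj₂ (x∈⁅y⁆⇒x≡y c x∈c))

toℕ-next : ∀ {m} (i : Fin (suc m)) → toℕ (next i) ≡ suc (toℕ i) % suc m
toℕ-next i = toℕ-fromℕ< _

next-fromℕ : ∀ m → next (fromℕ m) ≡ zero
next-fromℕ m = toℕ-injective (begin
  toℕ (next (fromℕ m))          ≡⟨ toℕ-next (fromℕ m) ⟩
  suc (toℕ (fromℕ m)) % suc m   ≡⟨ cong (λ k → suc k % suc m) (toℕ-fromℕ m) ⟩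
  suc m % suc m                 ≡⟨ n%n≡0 (suc m) ⟩
  0                             ∎)

next-inject₁ : ∀ {m} (j : Fin m) → next (inject₁ j) ≡ suc j
next-inject₁ {m} j = toℕ-injective (begin
  toℕ (next (inject₁ j))          ≡⟨ toℕ-next (inject₁ j) ⟩
  suc (toℕ (inject₁ j)) % suc m   ≡⟨ cong (λ k → suc k % suc m) (toℕ-inject₁ j) ⟩
  suc (toℕ j) % suc m             ≡⟨ m<n⇒m%n≡m (s≤s (toℕ<n j)) ⟩
  suc (toℕ j)                     ∎)

prev : ∀ {m} → Fin (suc m) → Fin (suc m)
prev {m} zero = fromℕ m
prev (suc j)  = inject₁ j

next-prev : ∀ {m} (i : Fin (suc m)) → next (prev i) ≡ i
next-prev {m} zero = next-fromℕ m
next-prev (suc j)  = next-inject₁ j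

prev-next : ∀ {m} (i : Fin (suc m)) → prev (next i) ≡ i
prev-next i with view i
... | ‵fromℕ     = cong prev (next-fromℕ _)
... | ‵inject₁ j = cong prev (next-inject₁ j)

next-injective : ∀ {m} {i j : Fin (suc m)} → next i ≡ next j → i ≡ j
next-injective {i = i} {j} eq = trans (sym (prev-next i)) (trans (cong prev eq) (prev-next j))

suc≢inject₁ : ∀ {m} (j : Fin m) → suc j ≢ inject₁ j
suc≢inject₁ j eq = 1+n≢n (trans (cong toℕ eq) (toℕ-inject₁ j))

next-≢ : ∀ {m} → 1 ≤ m → (i : Fin (suc m)) → next i ≢ i
next-≢ (s≤s z≤n) i eq with view i
... | ‵fromℕ     = 0≢1+n (trans (sym (next-fromℕ _)) eq)
... | ‵inject₁ j = suc≢inject₁ j (trans (sym (next-inject₁ j)) eq)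

next²-≢ : ∀ {m} → 2 ≤ m → (i : Fin (suc m)) → next (next i) ≢ i
next²-≢ (s≤s (s≤s z≤n)) i eq with view i
... | ‵fromℕ = 0≢1+n (suc-injective (begin
      suc zero                ≡⟨ next-inject₁ zero ⟨
      next zero               ≡⟨ cong next (next-fromℕ _) ⟨
      next (next (fromℕ _))   ≡⟨ eq ⟩
      fromℕ _                 ∎))
... | ‵inject₁ j with view j
...   | ‵fromℕ = 0≢1+n (begin
        zero                            ≡⟨ next-fromℕ _ ⟨
        next (suc (fromℕ _))            ≡⟨ cong next (next-inject₁ j) ⟨
        next (next (inject₁ j))         ≡⟨ eq ⟩
        inject₁ j                       ∎)
...   | ‵inject₁ j′ = m+1+n≢n 1 (begin
        toℕ (suc (suc j′))              ≡⟨ cong toℕ (next-inject₁ (suc j′)) ⟨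
        toℕ (next (suc j))              ≡⟨ cong (toℕ ∘ next) (next-inject₁ j) ⟨
        toℕ (next (next (inject₁ j)))   ≡⟨ cong toℕ eq ⟩
        toℕ (inject₁ j)                 ≡⟨ toℕ-inject₁ j ⟩
        toℕ j                           ≡⟨ toℕ-inject₁ j′ ⟩
        toℕ j′                          ∎)

Fin2-pigeonhole : {i j k : Fin 2} → i ≢ j → i ≢ k → j ≡ k
Fin2-pigeonhole {zero}     {zero}               i≢j _   = ⊥-elim (i≢j refl)
Fin2-pigeonhole {zero}     {suc zero} {zero}     _   i≢k = ⊥-elim (i≢k refl)
Fin2-pigeonhole {zero}     {suc zero} {suc zero} _   _   = refl
Fin2-pigeonhole {suc zero} {suc zero}           i≢j _   = ⊥-elim (i≢j refl)
Fin2-pigeonhole {suc zero} {zero}     {suc zero} _   i≢k = ⊥-elim (i≢k refl)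
Fin2-pigeonhole {suc zero} {zero}     {zero}     _   _   = refl

distinct-triple⇒2≤ : ∀ {m} {i j k : Fin (suc m)} → i ≢ j → i ≢ k → j ≢ k → 2 ≤ m
distinct-triple⇒2≤ {zero} {zero} {zero} i≢j _ _ = ⊥-elim (i≢j refl)
distinct-triple⇒2≤ {suc zero} i≢j i≢k j≢k       = ⊥-elim (j≢k (Fin2-pigeonhole i≢j i≢k))
distinct-triple⇒2≤ {suc (suc m)} _ _ _            = s≤s (s≤s z≤n)

-- Circuits

Incident : (G : SignedGraph) → Fin (nE G) → Fin (nV G) → Set
Incident G e w = proj₁ (ends G e) ≡ w ⊎ proj₂ (ends G e) ≡ w

ClawFree : ∀ {k} {W : Set} → (Fin k → W → Set) → Subset k → Set
ClawFree _touches_ M = ∀ {a b c} → a ∈ M → b ∈ M → c ∈ M → a ≢ b → a ≢ c → b ≢ c →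
  ∀ w → ¬ (a touches w × b touches w × c touches w)

Through : ∀ {k} → Fin k → Subset k → Set
Through p M = p ∈ M × ∃₂ λ a b → a ∈ M × b ∈ M × a ≢ p × b ≢ p × a ≢ b

record Exits {k} {W : Set} (_touches_ : Fin k → W → Set) (M : Subset k) (p : Fin k) (u v : W) : Set where
  field
    s t         : Fin k
    s∈M         : s ∈ M
    t∈M         : t ∈ M
    s≢p         : s ≢ p
    t≢p         : t ≢ p
    s≢t         : s ≢ t
    s-touches-u : s touches u
    t-touches-v : t touches v

module _ (G : SignedGraph) where

  joins-incident₁ : ∀ {e a b} → Joins G e a b → Incident G e a
  joins-incident₁ (inj₁ eq) = inj₁ (cong proj₁ eq)
  joins-incident₁ (inj₂ eq) = inj₂ (cong proj₂ eq)

  joins-incident₂ : ∀ {e a b} → Joins G e a b → Incident G e b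
  joins-incident₂ (inj₁ eq) = inj₂ (cong proj₂ eq)
  joins-incident₂ (inj₂ eq) = inj₁ (cong proj₁ eq)

  incident-joins : ∀ {e a b w} → Joins G e a b → Incident G e w → w ≡ a ⊎ w ≡ b
  incident-joins (inj₁ eq) (inj₁ e∼w) = inj₁ (trans (sym e∼w) (cong proj₁ eq))
  incident-joins (inj₁ eq) (inj₂ e∼w) = inj₂ (trans (sym e∼w) (cong proj₂ eq))
  incident-joins (inj₂ eq) (inj₁ e∼w) = inj₂ (trans (sym e∼w) (cong proj₁ eq))
  incident-joins (inj₂ eq) (inj₂ e∼w) = inj₁ (trans (sym e∼w) (cong proj₂ eq))

  circuit-claw-free : ∀ {C} → IsCircuit G C → ClawFree (Incident G) C
  circuit-claw-free (m , vs , es , vs-inj , es-inj , joins , mem) a∈C b∈C c∈C a≢b a≢c b≢c w (a∼w , b∼w , c∼w)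
    with proj₁ (mem _) a∈C | proj₁ (mem _) b∈C | proj₁ (mem _) c∈C
  ... | i , refl | j , refl | k , refl = claw (side i a∼w) (side j b∼w) (side k c∼w)
    -- w occurs at most once on the circuit: at most one edge starts and at most one ends there.
    where
    Side : Fin (suc m) → Set
    Side i = w ≡ vs i ⊎ w ≡ vs (next i)

    side : ∀ i → Incident G (es i) w → Side i
    side i = incident-joins (joins i)

    same-start : ∀ {i j} → w ≡ vs i → w ≡ vs j → es i ≡ es j
    same-start p q = cong es (vs-inj (trans (sym p) q))

    same-end : ∀ {i j} → w ≡ vs (next i) → w ≡ vs (next j) → es i ≡ es j
    same-end p q = cong es (next-injective (vs-inj (trans (sym p) q)))

    claw : Side i → Side j → Side k → Empty.⊥
    claw (inj₁ p) (inj₁ q) _        = a≢b (same-start p q)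
    claw (inj₁ p) (inj₂ q) (inj₁ r) = a≢c (same-start p r)
    claw (inj₁ p) (inj₂ q) (inj₂ r) = b≢c (same-end q r)
    claw (inj₂ p) (inj₂ q) _        = a≢b (same-end p q)
    claw (inj₂ p) (inj₁ q) (inj₁ r) = b≢c (same-start q r)
    claw (inj₂ p) (inj₁ q) (inj₂ r) = a≢c (same-end p r)

  -- The exits are the circuit edges just before and just after f.
  circuit-exits : ∀ {C f} → IsCircuit G C → Through f C →
                  Exits (Incident G) C f (proj₁ (ends G f)) (proj₂ (ends G f))
  circuit-exits {C} (m , vs , es , vs-inj , es-inj , joins , mem) (f∈C , a , b , a∈C , b∈C , a≢f , b≢f , a≢b)
    with proj₁ (mem _) f∈C | proj₁ (mem _) a∈C | proj₁ (mem _) b∈C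
  ... | k , refl | i , refl | j , refl = orient (joins k)
    where
    2≤m : 2 ≤ m
    2≤m = distinct-triple⇒2≤ {i = k} (λ k≡i → a≢f (cong es (sym k≡i)))
            (λ k≡j → b≢f (cong es (sym k≡j))) (λ i≡j → a≢b (cong es i≡j))

    before-in : es (prev k) ∈ C
    before-in = proj₂ (mem _) (prev k , refl)
    after-in : es (next k) ∈ C
    after-in = proj₂ (mem _) (next k , refl)

    before-touches : Incident G (es (prev k)) (vs k)
    before-touches = subst (Incident G (es (prev k))) (cong vs (next-prev k)) (joins-incident₂ (joins (prev k)))
    after-touches : Incident G (es (next k)) (vs (next k))
    after-touches = joins-incident₁ (joins (next k))

    before≢f : es (prev k) ≢ es k
    before≢f eq = next-≢ (<⇒≤ 2≤m) k (trans (cong next (sym (es-inj eq))) (next-prev k))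
    after≢f : es (next k) ≢ es k
    after≢f eq = next-≢ (<⇒≤ 2≤m) k (es-inj eq)
    before≢after : es (prev k) ≢ es (next k)
    before≢after eq = next²-≢ 2≤m k (trans (cong next (sym (es-inj eq))) (next-prev k))

    orient : Joins G (es k) (vs k) (vs (next k)) → Exits (Incident G) C (es k) (proj₁ (ends G (es k))) (proj₂ (ends G (es k)))
    orient (inj₁ eq) = record
      { s = es (prev k) ; t = es (next k) ; s∈M = before-in ; t∈M = after-in
      ; s≢p = before≢f ; t≢p = after≢f ; s≢t = before≢after
      ; s-touches-u = subst (Incident G _) (sym (cong proj₁ eq)) before-touches
      ; t-touches-v = subst (Incident G _) (sym (cong proj₂ eq)) after-touches }
    orient (inj₂ eq) = record
      { s = es (next k) ; t = es (prev k) ; s∈M = after-in ; t∈M = before-in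
      ; s≢p = after≢f ; t≢p = before≢f ; s≢t = before≢after ∘ sym
      ; s-touches-u = subst (Incident G _) (sym (cong proj₁ eq)) after-touches
      ; t-touches-v = subst (Incident G _) (sym (cong proj₂ eq)) before-touches }

claw-free-⊆ : ∀ {k} {W : Set} {T : Fin k → W → Set} {M N} → M ⊆ N → ClawFree T N → ClawFree T M
claw-free-⊆ M⊆N claw-free a∈M b∈M c∈M = claw-free (M⊆N a∈M) (M⊆N b∈M) (M⊆N c∈M)

through-⊆ : ∀ {k} {p : Fin k} {M N} → M ⊆ N → Through p M → Through p N
through-⊆ M⊆N (p∈M , a , b , a∈M , b∈M , distinct) = M⊆N p∈M , a , b , M⊆N a∈M , M⊆N b∈M , distinct

exits-restrict : ∀ {k} {W : Set} {T : Fin k → W → Set} {M N p u v} →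
          (∀ {e} → e ∈ N → e ≢ p → e ∈ M) → Exits T N p u v → Exits T M p u v
exits-restrict keep E = record
  { s = s ; t = t ; s∈M = keep s∈M s≢p ; t∈M = keep t∈M t≢p
  ; s≢p = s≢p ; t≢p = t≢p ; s≢t = s≢t ; s-touches-u = s-touches-u ; t-touches-v = t-touches-v }
  where open Exits E

flow-negative-unique : ∀ {G C e e′} → IsFlow G C → e ∈ C → e ∈ E⁻ G → e′ ∈ C → e′ ∈ E⁻ G → e ≡ e′
flow-negative-unique (_ , one-negative) e∈C e∈E⁻ e′∈C e′∈E⁻ =
  ∣p∣≡1⇒x≡y one-negative (x∈p∩q⁺ (e∈C , e∈E⁻)) (x∈p∩q⁺ (e′∈C , e′∈E⁻))

module _ (G : SignedGraph) {J : Subset (nE G)} (J⊆E⁻ : J ⊆ E⁻ G) where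

  contraction-member-claw-free : ∀ {M} → Mem (minor (flowClutter G) ⊥ J) M → ClawFree (Incident G) M
  contraction-member-claw-free ((C , flow , _ , refl) , _) =
    claw-free-⊆ (proj₁ ∘ x∈p─q⁻) (circuit-claw-free G (proj₁ flow))

  -- Contracting negative edges other than f leaves a flow through f unchanged.
  contraction-member-exits : ∀ {M f} → Mem (minor (flowClutter G) ⊥ J) M → f ∈ E⁻ G → Through f M →
                             Exits (Incident G) M f (proj₁ (ends G f)) (proj₂ (ends G f))
  contraction-member-exits {f = f} ((C , flow , _ , refl) , _) f∈E⁻ through =
    exits-restrict kept (circuit-exits G (proj₁ flow) (through-⊆ C─J⊆C through))
    where
    C─J⊆C : C ─ J ⊆ C
    C─J⊆C = proj₁ ∘ x∈p─q⁻
    kept : ∀ {e} → e ∈ C → e ≢ f → e ∈ C ─ J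
    kept e∈C e≢f = x∈p─q⁺ e∈C λ e∈J →
      e≢f (flow-negative-unique {G} flow e∈C (J⊆E⁻ e∈J) (C─J⊆C (proj₁ through)) f∈E⁻)

-- What a clutter isomorphic to F / J inherits at the image p of a negative
-- edge uv outside J: q touches w when the edge corresponding to q is
-- incident with the vertex w.
record Realisation (W : Set) {k} (D : Clutter k) (p : Fin k) : Set₁ where
  field
    _touches_   : Fin k → W → Set
    u v         : W
    p-touches-u : p touches u
    claw-free   : ∀ {M} → Mem D M → ClawFree _touches_ M
    exits       : ∀ {M} → Mem D M → Through p M → Exits _touches_ M p u v

module IsoInverse {n m} {C : Clutter n} {D : Clutter m} (φ : Fin n → Fin m) (γ : Fin m → Fin n)
         (γ-ground : ∀ q → q ∈ ground D → γ q ∈ ground C × φ (γ q) ≡ q)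
         (members : ∀ X → X ⊆ ground C → (Mem C X → Mem D (image φ X)) × (Mem D (image φ X) → Mem C X))
         (D-full : ∀ q → q ∈ ground D) where

  φ∘γ : ∀ q → φ (γ q) ≡ q
  φ∘γ q = proj₂ (γ-ground q (D-full q))

  γ-injective : ∀ {q q′} → γ q ≡ γ q′ → q ≡ q′
  γ-injective {q} {q′} eq = trans (sym (φ∘γ q)) (trans (cong φ eq) (φ∘γ q′))

  γ-member : ∀ {M} → Mem D M → Mem C (image γ M)
  γ-member {M} M∈D =
    proj₂ (members (image γ M) image-γ-⊆) (subst (Mem D) (sym (image-inverse {φ = φ} {γ} φ∘γ M)) M∈D)
    where
    image-γ-⊆ : image γ M ⊆ ground C
    image-γ-⊆ e∈ with image⁻ γ M e∈
    ... | q , _ , refl = proj₁ (γ-ground q (D-full q))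

  γ-≢ : ∀ {q q′} → q ≢ q′ → γ q ≢ γ q′
  γ-≢ q≢q′ = q≢q′ ∘ γ-injective

  claw-free-image⁻ : ∀ {W : Set} {T : Fin n → W → Set} {M} → ClawFree T (image γ M) → ClawFree (λ q → T (γ q)) M
  claw-free-image⁻ claw-free a∈M b∈M c∈M a≢b a≢c b≢c =
    claw-free (image⁺ γ a∈M) (image⁺ γ b∈M) (image⁺ γ c∈M) (γ-≢ a≢b) (γ-≢ a≢c) (γ-≢ b≢c)

  through-image⁺ : ∀ {p M} → Through p M → Through (γ p) (image γ M)
  through-image⁺ (p∈M , a , b , a∈M , b∈M , a≢p , b≢p , a≢b) =
    image⁺ γ p∈M , γ a , γ b , image⁺ γ a∈M , image⁺ γ b∈M , γ-≢ a≢p , γ-≢ b≢p , γ-≢ a≢b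

  exits-image⁻ : ∀ {W : Set} {T : Fin n → W → Set} {M p u v} →
                 Exits T (image γ M) (γ p) u v → Exits (λ q → T (γ q)) M p u v
  exits-image⁻ {T = T} {M} {p} {u} {v} E = pull-back (image⁻ γ M s∈M) (image⁻ γ M t∈M)
    where
    open Exits E
    pull-back : (∃ λ q → q ∈ M × γ q ≡ s) → (∃ λ q → q ∈ M × γ q ≡ t) → Exits (λ q → T (γ q)) M p u v
    pull-back (qs , qs∈M , refl) (qt , qt∈M , refl) = record
      { s = qs ; t = qt ; s∈M = qs∈M ; t∈M = qt∈M
      ; s≢p = s≢p ∘ cong γ ; t≢p = t≢p ∘ cong γ ; s≢t = s≢t ∘ cong γ
      ; s-touches-u = s-touches-u ; t-touches-v = t-touches-v }

realisation : ∀ (G : SignedGraph) {J f} → J ⊆ E⁻ G → f ∈ E⁻ G → f ∉ J →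
              ∀ {k} {D : Clutter k} → (∀ q → q ∈ ground D) → (iso : Iso (minor (flowClutter G) ⊥ J) D) →
              Realisation (Fin (nV G)) D (proj₁ iso f)
realisation G {J} {f} J⊆E⁻ f∈E⁻ f∉J {D = D} D-full (φ , γ , φ-ground , γ-ground , members) = record
  { _touches_   = λ q → Incident G (γ q)
  ; u           = proj₁ (ends G f)
  ; v           = proj₂ (ends G f)
  ; p-touches-u = inj₁ (cong (proj₁ ∘ ends G) γφf)
  ; claw-free   = λ M∈D → claw-free-image⁻ (contraction-member-claw-free G J⊆E⁻ (γ-member M∈D))
  ; exits       = exits
  }
  where
  open IsoInverse {C = minor (flowClutter G) ⊥ J} {D = D} φ γ γ-ground members D-full
  f∈ground : f ∈ ⊤ ─ (⊥ ∪ J)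
  f∈ground = x∈p─q⁺ ∈⊤ ([ ∉⊥ , f∉J ]′ ∘ x∈p∪q⁻ ⊥ J)
  γφf : γ (φ f) ≡ f
  γφf = proj₂ (φ-ground f f∈ground)
  exits : ∀ {M} → Mem D M → Through (φ f) M →
          Exits (λ q → Incident G (γ q)) M (φ f) (proj₁ (ends G f)) (proj₂ (ends G f))
  exits {M} M∈D through = exits-image⁻ (subst (λ e → Exits (Incident G) (image γ M) e _ _) (sym γφf) exits-at-f)
    where
    exits-at-f : Exits (Incident G) (image γ M) f (proj₁ (ends G f)) (proj₂ (ends G f))
    exits-at-f = contraction-member-exits G J⊆E⁻ (γ-member M∈D) f∈E⁻
                   (subst (λ e → Through e (image γ M)) γφf (through-image⁺ through))

ThreeMember : ∀ {k} → Clutter k → Fin k → Fin k → Fin k → Set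
ThreeMember D a b c = Mem D (⁅ a ⁆ ∪ ⁅ b ⁆ ∪ ⁅ c ⁆) × a ≢ b × a ≢ c × b ≢ c

module _ {A : Set} (U V : A → Set) where

  Split : A → A → Set
  Split a b = (U a × V b) ⊎ (U b × V a)

  Monochromatic : A → A → A → Set
  Monochromatic a b c = (U a × U b × U c) ⊎ (V a × V b × V c)

  -- In F₇, with eᵢ = p + i, the pairs are the lines through p with p removed
  -- and the four triples are the lines avoiding p.
  fano-split : ∀ {e₁ e₂ e₃ e₄ e₅ e₆} → Split e₁ e₃ → Split e₄ e₅ → Split e₆ e₂ →
    Monochromatic e₁ e₂ e₄ ⊎ Monochromatic e₂ e₃ e₅ ⊎ Monochromatic e₃ e₄ e₆ ⊎ Monochromatic e₅ e₆ e₁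
  fano-split (inj₁ (u₁ , v₃)) (inj₁ (u₄ , v₅)) (inj₁ (u₆ , v₂)) = inj₂ (inj₁ (inj₂ (v₂ , v₃ , v₅)))
  fano-split (inj₁ (u₁ , v₃)) (inj₁ (u₄ , v₅)) (inj₂ (u₂ , v₆)) = inj₁ (inj₁ (u₁ , u₂ , u₄))
  fano-split (inj₁ (u₁ , v₃)) (inj₂ (u₅ , v₄)) (inj₁ (u₆ , v₂)) = inj₂ (inj₂ (inj₂ (inj₁ (u₅ , u₆ , u₁))))
  fano-split (inj₁ (u₁ , v₃)) (inj₂ (u₅ , v₄)) (inj₂ (u₂ , v₆)) = inj₂ (inj₂ (inj₁ (inj₂ (v₃ , v₄ , v₆))))
  fano-split (inj₂ (u₃ , v₁)) (inj₁ (u₄ , v₅)) (inj₁ (u₆ , v₂)) = inj₂ (inj₂ (inj₁ (inj₁ (u₃ , u₄ , u₆))))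
  fano-split (inj₂ (u₃ , v₁)) (inj₁ (u₄ , v₅)) (inj₂ (u₂ , v₆)) = inj₂ (inj₂ (inj₂ (inj₂ (v₅ , v₆ , v₁))))
  fano-split (inj₂ (u₃ , v₁)) (inj₂ (u₅ , v₄)) (inj₁ (u₆ , v₂)) = inj₁ (inj₂ (v₁ , v₂ , v₄))
  fano-split (inj₂ (u₃ , v₁)) (inj₂ (u₅ , v₄)) (inj₂ (u₂ , v₆)) = inj₂ (inj₁ (inj₁ (u₂ , u₃ , u₅)))

module RealisationProperties {W : Set} {k} {D : Clutter k} {p} (R : Realisation W D p) where
  open Realisation R

  split : ∀ {a b} → ThreeMember D p a b → Split (_touches u) (_touches v) a b
  split {a} {b} (line , p≢a , p≢b , a≢b) =
    orient (∈-triple⁻ s∈M) (∈-triple⁻ t∈M) s≢p t≢p s≢t s-touches-u t-touches-v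
    where
    open Exits (exits line (∈-triple₁ , a , b , ∈-triple₂ , ∈-triple₃ , p≢a ∘ sym , p≢b ∘ sym , a≢b))
    orient : ∀ {x y} → x ≡ p ⊎ x ≡ a ⊎ x ≡ b → y ≡ p ⊎ y ≡ a ⊎ y ≡ b → x ≢ p → y ≢ p → x ≢ y →
             x touches u → y touches v → Split (_touches u) (_touches v) a b
    orient (inj₁ x≡p)        _                  x≢p _   _   _  _  = ⊥-elim (x≢p x≡p)
    orient _                 (inj₁ y≡p)         _   y≢p _   _  _  = ⊥-elim (y≢p y≡p)
    orient (inj₂ (inj₁ refl)) (inj₂ (inj₁ refl)) _   _   x≢y _  _  = ⊥-elim (x≢y refl)
    orient (inj₂ (inj₁ refl)) (inj₂ (inj₂ refl)) _   _   _   xu yv = inj₁ (xu , yv)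
    orient (inj₂ (inj₂ refl)) (inj₂ (inj₁ refl)) _   _   _   xu yv = inj₂ (xu , yv)
    orient (inj₂ (inj₂ refl)) (inj₂ (inj₂ refl)) _   _   x≢y _  _  = ⊥-elim (x≢y refl)

  not-monochromatic : ∀ {a b c} → ThreeMember D a b c → ¬ Monochromatic (_touches u) (_touches v) a b c
  not-monochromatic (line , a≢b , a≢c , b≢c) (inj₁ at-u) =
    claw-free line ∈-triple₁ ∈-triple₂ ∈-triple₃ a≢b a≢c b≢c u at-u
  not-monochromatic (line , a≢b , a≢c , b≢c) (inj₂ at-v) =
    claw-free line ∈-triple₁ ∈-triple₂ ∈-triple₃ a≢b a≢c b≢c v at-v

  no-fano-star : ∀ {e₁ e₂ e₃ e₄ e₅ e₆} →
    ThreeMember D p e₁ e₃ → ThreeMember D p e₄ e₅ → ThreeMember D p e₆ e₂ →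
    ThreeMember D e₁ e₂ e₄ → ThreeMember D e₂ e₃ e₅ → ThreeMember D e₃ e₄ e₆ → ThreeMember D e₅ e₆ e₁ →
    Empty.⊥
  no-fano-star l₁₃ l₄₅ l₆₂ l₁₂₄ l₂₃₅ l₃₄₆ l₅₆₁
    with fano-split (_touches u) (_touches v) (split l₁₃) (split l₄₅) (split l₆₂)
  ... | inj₁ mono                      = not-monochromatic l₁₂₄ mono
  ... | inj₂ (inj₁ mono)               = not-monochromatic l₂₃₅ mono
  ... | inj₂ (inj₂ (inj₁ mono))        = not-monochromatic l₃₄₆ mono
  ... | inj₂ (inj₂ (inj₂ mono))        = not-monochromatic l₅₆₁ mono

  -- Q₁ and Q₂ each have an element other than p at u; with p they lie in a member K.
  no-crossing : ∀ {Q₁ Q₂} → Mem D Q₁ → Mem D Q₂ → Through p Q₁ → Through p Q₂ →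
    (∀ {s t} → s ∈ Q₁ → t ∈ Q₂ → s ≢ p → t ≢ p → s ≢ t × ∃ λ K → Mem D K × p ∈ K × s ∈ K × t ∈ K) →
    Empty.⊥
  no-crossing Q₁∈D Q₂∈D through₁ through₂ crossing
    with exits Q₁∈D through₁ | exits Q₂∈D through₂
  ... | E₁ | E₂ with crossing (Exits.s∈M E₁) (Exits.s∈M E₂) (Exits.s≢p E₁) (Exits.s≢p E₂)
  ...   | s₁≢s₂ , K , K∈D , p∈K , s₁∈K , s₂∈K =
    claw-free K∈D p∈K s₁∈K s₂∈K (Exits.s≢p E₁ ∘ sym) (Exits.s≢p E₂ ∘ sym) s₁≢s₂ u
      (p-touches-u , Exits.s-touches-u E₁ , Exits.s-touches-u E₂)

three-member? : ∀ {k} {D : Clutter k} → (∀ X → Dec (Mem D X)) → ∀ a b c → Dec (ThreeMember D a b c)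
three-member? member? a b c =
  member? (⁅ a ⁆ ∪ ⁅ b ⁆ ∪ ⁅ c ⁆) ×-dec ¬? (a ≟ b) ×-dec ¬? (a ≟ c) ×-dec ¬? (b ≟ c)

-- The Fano plane

_⊕_ : Fin 7 → ℕ → Fin 7
p ⊕ i = (toℕ p + i) mod 7

FanoStar : Fin 7 → Set
FanoStar p =
  ThreeMember F₇ p (p ⊕ 1) (p ⊕ 3) × ThreeMember F₇ p (p ⊕ 4) (p ⊕ 5) × ThreeMember F₇ p (p ⊕ 6) (p ⊕ 2) ×
  ThreeMember F₇ (p ⊕ 1) (p ⊕ 2) (p ⊕ 4) × ThreeMember F₇ (p ⊕ 2) (p ⊕ 3) (p ⊕ 5) ×
  ThreeMember F₇ (p ⊕ 3) (p ⊕ 4) (p ⊕ 6) × ThreeMember F₇ (p ⊕ 5) (p ⊕ 6) (p ⊕ 1)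

F₇-member? : ∀ X → Dec (Mem F₇ X)
F₇-member? X = Any.any? (≡-dec _≟ᵇ_ X) fanoLines

F₇-star : ∀ p → FanoStar p
F₇-star = toWitness {a? = all? λ p →
  line? p (p ⊕ 1) (p ⊕ 3) ×-dec line? p (p ⊕ 4) (p ⊕ 5) ×-dec line? p (p ⊕ 6) (p ⊕ 2) ×-dec
  line? (p ⊕ 1) (p ⊕ 2) (p ⊕ 4) ×-dec line? (p ⊕ 2) (p ⊕ 3) (p ⊕ 5) ×-dec
  line? (p ⊕ 3) (p ⊕ 4) (p ⊕ 6) ×-dec line? (p ⊕ 5) (p ⊕ 6) (p ⊕ 1)} _
  where
  line? : ∀ a b c → Dec (ThreeMember F₇ a b c)
  line? = three-member? {D = F₇} F₇-member?

F₇-unrealisable : ∀ {W} p → ¬ Realisation W F₇ p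
F₇-unrealisable p R = no-star (F₇-star p)
  where
  no-star : FanoStar p → Empty.⊥
  no-star (l₁₃ , l₄₅ , l₆₂ , l₁₂₄ , l₂₃₅ , l₃₄₆ , l₅₆₁) =
    RealisationProperties.no-fano-star R l₁₃ l₄₅ l₆₂ l₁₂₄ l₂₃₅ l₃₄₆ l₅₆₁

-- The blocker of τ(K₅)

blocker-member : ∀ {k} {D : Clutter k} {X} → X ⊆ ground D → (∀ C → Mem D C → Nonempty (X ∩ C)) →
  (∀ {e} → e ∈ X → ∃ λ C → Mem D C × ∀ {e′} → e′ ∈ X → e′ ∈ C → e′ ≡ e) → Mem (blocker D) X
blocker-member {D = D} {X} X⊆ground transversal isolating = (X⊆ground , transversal) , minimal
  where
  minimal : ∀ Y → Transversal D Y → Y ⊆ X → Y ≡ X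
  minimal Y (_ , Y-transversal) Y⊆X = ⊆-antisym Y⊆X X⊆Y
    where
    X⊆Y : X ⊆ Y
    X⊆Y e∈X with isolating e∈X
    ... | C , C∈D , only-e with Y-transversal C C∈D
    ...   | e′ , e′∈Y∩C with x∈p∩q⁻ Y C e′∈Y∩C
    ...     | e′∈Y , e′∈C = subst (_∈ Y) (only-e (Y⊆X e′∈Y) e′∈C) e′∈Y

TriangleTransversal : Subset 10 → Set
TriangleTransversal X = ∀ a b c → a ≢ b → a ≢ c → b ≢ c → Nonempty (X ∩ triangle a b c)

IsolatingTriangles : Subset 10 → Set
IsolatingTriangles X = ∀ e → e ∈ X → ∃₂ λ a b → ∃ λ c → (a ≢ b × a ≢ c × b ≢ c) ×
  (∀ e′ → e′ ∈ X → e′ ∈ triangle a b c → e′ ≡ e)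

triangle-transversal? : ∀ X → Dec (TriangleTransversal X)
triangle-transversal? X = all? λ a → all? λ b → all? λ c →
  ¬? (a ≟ b) →-dec ¬? (a ≟ c) →-dec ¬? (b ≟ c) →-dec nonempty? (X ∩ triangle a b c)

isolating-triangles? : ∀ X → Dec (IsolatingTriangles X)
isolating-triangles? X = all? λ e → (e ∈? X) →-dec any? λ a → any? λ b → any? λ c →
  (¬? (a ≟ b) ×-dec ¬? (a ≟ c) ×-dec ¬? (b ≟ c)) ×-dec
  all? λ e′ → (e′ ∈? X) →-dec (e′ ∈? triangle a b c) →-dec (e′ ≟ e)

τK₅-blocker-member : ∀ {X} → TriangleTransversal X × IsolatingTriangles X → Mem (blocker τK₅) X
τK₅-blocker-member {X} (transversal , isolating) = blocker-member (λ _ → ∈⊤) meets-triangles isolated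
  where
  meets-triangles : ∀ C → Mem τK₅ C → Nonempty (X ∩ C)
  meets-triangles _ (a , b , c , a≢b , a≢c , b≢c , refl) = transversal a b c a≢b a≢c b≢c
  isolated : ∀ {e} → e ∈ X → ∃ λ C → Mem τK₅ C × ∀ {e′} → e′ ∈ X → e′ ∈ C → e′ ≡ e
  isolated e∈X with isolating _ e∈X
  ... | a , b , c , (a≢b , a≢c , b≢c) , only-e = triangle a b c , (a , b , c , a≢b , a≢c , b≢c , refl) , only-e _

endpoint : Fin 5 → Fin 10 → Bool
endpoint i e = ⌊ proj₁ (k5edge e) ≟ i ⌋ ∨ ⌊ proj₂ (k5edge e) ≟ i ⌋

edge-and-opposite-triangle : Fin 10 → Subset 10
edge-and-opposite-triangle e₀ = tabulate λ e →
  ⌊ e ≟ e₀ ⌋ ∨ not (endpoint (proj₁ (k5edge e₀)) e ∨ endpoint (proj₂ (k5edge e₀)) e)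

K₄-avoiding : Fin 5 → Subset 10
K₄-avoiding i = tabulate λ e → not (endpoint i e)

-- Two of the three kinds of minimal transversals of τ(K₅).
τK₅-transversals : List (Subset 10)
τK₅-transversals = map edge-and-opposite-triangle (allFin 10) ++ map K₄-avoiding (allFin 5)

τK₅-transversals-minimal : All (Mem (blocker τK₅)) τK₅-transversals
τK₅-transversals-minimal = All.map τK₅-blocker-member
  (toWitness {a? = All.all? (λ X → triangle-transversal? X ×-dec isolating-triangles? X) τK₅-transversals} _)

through? : ∀ {k} (p : Fin k) M → Dec (Through p M)
through? p M = (p ∈? M) ×-dec any? λ a → any? λ b →
  (a ∈? M) ×-dec (b ∈? M) ×-dec ¬? (a ≟ p) ×-dec ¬? (b ≟ p) ×-dec ¬? (a ≟ b)

CrossingIn : ∀ {k} → List (Subset k) → Fin k → Subset k → Subset k → Set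
CrossingIn L p Q₁ Q₂ = Through p Q₁ × Through p Q₂ ×
  (∀ s t → s ∈ Q₁ → t ∈ Q₂ → s ≢ p → t ≢ p → s ≢ t × Any (λ K → p ∈ K × s ∈ K × t ∈ K) L)

crossing-in? : ∀ {k} L (p : Fin k) Q₁ Q₂ → Dec (CrossingIn L p Q₁ Q₂)
crossing-in? L p Q₁ Q₂ = through? p Q₁ ×-dec through? p Q₂ ×-dec
  all? λ s → all? λ t → (s ∈? Q₁) →-dec (t ∈? Q₂) →-dec ¬? (s ≟ p) →-dec ¬? (t ≟ p) →-dec
    ¬? (s ≟ t) ×-dec Any.any? (λ K → (p ∈? K) ×-dec (s ∈? K) ×-dec (t ∈? K)) L

τK₅-crossings : ∀ p → Any (λ Q₁ → Any (CrossingIn τK₅-transversals p Q₁) τK₅-transversals) τK₅-transversals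
τK₅-crossings = toWitness {a? = all? λ p →
  Any.any? (λ Q₁ → Any.any? (crossing-in? τK₅-transversals p Q₁) τK₅-transversals) τK₅-transversals} _

τK₅-blocker-unrealisable : ∀ {W} p → ¬ Realisation W (blocker τK₅) p
τK₅-blocker-unrealisable p R =
  let Q₁∈D , crossings = lookupAny τK₅-transversals-minimal (τK₅-crossings p)
      Q₂∈D , crossing  = lookupAny τK₅-transversals-minimal crossings
  in  no-crossing-at Q₁∈D Q₂∈D crossing
  where
  no-crossing-at : ∀ {Q₁ Q₂} → Mem (blocker τK₅) Q₁ → Mem (blocker τK₅) Q₂ →
                   CrossingIn τK₅-transversals p Q₁ Q₂ → Empty.⊥
  no-crossing-at Q₁∈D Q₂∈D (through₁ , through₂ , crossing) =
    RealisationProperties.no-crossing R Q₁∈D Q₂∈D through₁ through₂ λ s∈ t∈ s≢p t≢p →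
      let s≢t , K = crossing _ _ s∈ t∈ s≢p t≢p in
      s≢t , Any.lookup K , lookupAny τK₅-transversals-minimal K

E⁻₀⊆E⁻ : ∀ G x → E⁻₀ G x ⊆ E⁻ G
E⁻₀⊆E⁻ G x {e} e∈ = ∈⇒ (proj₁ (to T-∧ (∈-tabulate⁻ e∈)))
  where
  ∈⇒ : T (lookup (negative G) e) → e ∈ negative G
  ∈⇒ t = lookup⇒[]= e (negative G) (to T-≡ t)

lemma9 : (G : SignedGraph) → WeaklyMNI G →
  (x : Fin (nE G) → ℚ) → IsVertex (flowClutter G) x → Fractional x →
  MNI (minor (flowClutter G) ⊥ (E⁻₀ G x)) →
  E⁻₀ G x ≢ E⁻ G →
  ¬ Iso (minor (flowClutter G) ⊥ (E⁻₀ G x)) (blocker τK₅) ×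
  ¬ Iso (minor (flowClutter G) ⊥ (E⁻₀ G x)) F₇
lemma9 G _ x _ _ _ E⁻₀≢E⁻ with ⊆∧≢⇒∃∉ (E⁻₀⊆E⁻ G x) E⁻₀≢E⁻
... | f , f∈E⁻ , f∉E⁻₀ =
  (λ iso → τK₅-blocker-unrealisable (proj₁ iso f) (realise (λ _ → ∈⊤) iso)) ,
  (λ iso → F₇-unrealisable (proj₁ iso f) (realise (λ _ → ∈⊤) iso))
  where
  realise : ∀ {k} {D : Clutter k} → (∀ q → q ∈ ground D) → (iso : Iso (minor (flowClutter G) ⊥ (E⁻₀ G x)) D) →
            Realisation (Fin (nV G)) D (proj₁ iso f)
  realise = realisation G (E⁻₀⊆E⁻ G x) f∈E⁻ f∉E⁻₀
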